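{- A dicograph $R'$ is included in a dicograph $R$ (same domain) if and only if a term denoting $R$ rewrites to a term denoting $R'$ using the following rules, up to associativity of $\widehat{\otimes}$, $\widehat{<}$, $\widehat{⅋}$ and commutativity of $\widehat{⅋}$ and $\widehat{\otimes}$: $(X\,\widehat{⅋}\,Y)\,\widehat{\otimes}\,(U\,\widehat{⅋}\,V)\rightsquigarrow (X\,\widehat{\otimes}\,U)\,\widehat{⅋}\,(Y\,\widehat{\otimes}\,V)$; $(X\,\widehat{⅋}\,Y)\,\widehat{\otimes}\,U\rightsquigarrow (X\,\widehat{\otimes}\,U)\,\widehat{⅋}\,Y$; $Y\,\widehat{\otimes}\,U\rightsquigarrow U\,\widehat{⅋}\,Y$; $(X\,\widehat{<}\,Y)\,\widehat{\otimes}\,(U\,\widehat{<}\,V)\rightsquigarrow (X\,\widehat{\otimes}\,U)\,\widehat{<}\,(Y\,\widehat{\otimes}\,V)$; $(X\,\widehat{<}\,Y)\,\widehat{\otimes}\,U\rightsquigarrow (X\,\widehat{\otimes}\,U)\,\widehat{<}\,Y$; $Y\,\widehat{\otimes}\,(U\,\widehat{<}\,V)\rightsquigarrow U\,\widehat{<}\,(Y\,\widehat{\otimes}\,V)$; $Y\,\widehat{\otimes}\,U\rightsquigarrow U\,\widehat{<}\,Y$; $(X\,\widehat{⅋}\,Y)\,\widehat{<}\,(U\,\widehat{⅋}\,V)\rightsquigarrow (X\,\widehat{<}\,U)\,\widehat{⅋}\,(Y\,\widehat{<}\,V)$; $(X\,\widehat{⅋}\,Y)\,\widehat{<}\,U\rightsquigarrow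 (X\,\widehat{<}\,U)\,\widehat{⅋}\,Y$; $Y\,\widehat{<}\,(U\,\widehat{⅋}\,V)\rightsquigarrow U\,\widehat{⅋}\,(Y\,\widehat{<}\,V)$; $Y\,\widehat{<}\,U\rightsquigarrow U\,\widehat{⅋}\,Y$.
   Context: Dicographs are the smallest class of irreflexive binary relations containing the empty relation on singletons and closed under, for relations $R_1,R_2$ on disjoint domains $E_1,E_2$: symmetric series composition $R_1\,\widehat{\otimes}\,R_2=R_1\uplus R_2\uplus(E_1\times E_2)\uplus(E_2\times E_1)$; directed series composition $R_1\,\widehat{<}\,R_2=R_1\uplus R_2\uplus(E_1\times E_2)$; parallel composition $R_1\,\widehat{⅋}\,R_2=R_1\uplus R_2$ (⅋ is the par symbol). Each dicograph is denoted by a term over these three operations in which each element of the domain occurs exactly once, unique up to associativity of the three operations and commutativity of $\widehat{⅋}$ and $\widehat{\otimes}$. -}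

module Defs where

open import Data.Nat using (ℕ)
open import Data.Fin using (Fin)
open import Data.List using (List; [_]; _++_; allFin)
open import Data.List.Membership.Propositional using (_∈_)
open import Data.List.Relation.Binary.Permutation.Propositional using (_↭_)
open import Data.Product using (_×_; Σ-syntax)
open import Data.Sum using (_⊎_)
open import Data.Empty using (⊥)
open import Level using (0ℓ)
open import Relation.Binary.Core using (Rel)
open import Relation.Binary.Construct.Closure.ReflexiveTransitive using (Star)

-- Terms over atoms of type A, with the three operations
--   par  = parallel composition  (⅋^)
--   tens = symmetric series      (⊗^)
--   seq  = directed series       (<^)
data Term (A : Set) : Set where
  leaf : A → Term A
  par  : Term A → Term A → Term A
  tens : Term A → Term A → Term A
  seq  : Term A → Term A → Term A

atoms : {A : Set} → Term A → List A
atoms (leaf a)   = [ a ]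
atoms (par s t)  = atoms s ++ atoms t
atoms (tens s t) = atoms s ++ atoms t
atoms (seq s t)  = atoms s ++ atoms t

Linear : {n : ℕ} → Term (Fin n) → Set
Linear {n} t = atoms t ↭ allFin n

⟦_⟧ : {A : Set} → Term A → A → A → Set
⟦ leaf a ⟧   x y = ⊥
⟦ par s t ⟧  x y = ⟦ s ⟧ x y ⊎ ⟦ t ⟧ x y
⟦ tens s t ⟧ x y = ⟦ s ⟧ x y ⊎ ⟦ t ⟧ x y
                   ⊎ (x ∈ atoms s × y ∈ atoms t) ⊎ (x ∈ atoms t × y ∈ atoms s)
⟦ seq s t ⟧  x y = ⟦ s ⟧ x y ⊎ ⟦ t ⟧ x y ⊎ (x ∈ atoms s × y ∈ atoms t)

Denotes : {A : Set} → Term A → Rel A 0ℓ → Set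
Denotes t R = ∀ x y → (⟦ t ⟧ x y → R x y) × (R x y → ⟦ t ⟧ x y)

Dicograph : (n : ℕ) → Rel (Fin n) 0ℓ → Set
Dicograph n R = Σ[ t ∈ Term (Fin n) ] (Linear t × Denotes t R)

_⊆ᴿ_ : {A : Set} → Rel A 0ℓ → Rel A 0ℓ → Set
R' ⊆ᴿ R = ∀ x y → R' x y → R x y

data _≈_ {A : Set} : Term A → Term A → Set where
  ≈-refl  : ∀ {s} → s ≈ s
  ≈-sym   : ∀ {s t} → s ≈ t → t ≈ s
  ≈-trans : ∀ {s t u} → s ≈ t → t ≈ u → s ≈ u
  par-assoc  : ∀ {s t u} → par (par s t) u ≈ par s (par t u)
  tens-assoc : ∀ {s t u} → tens (tens s t) u ≈ tens s (tens t u)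
  seq-assoc  : ∀ {s t u} → seq (seq s t) u ≈ seq s (seq t u)
  par-comm   : ∀ {s t} → par s t ≈ par t s
  tens-comm  : ∀ {s t} → tens s t ≈ tens t s
  par-cong   : ∀ {s s' t t'} → s ≈ s' → t ≈ t' → par s t ≈ par s' t'
  tens-cong  : ∀ {s s' t t'} → s ≈ s' → t ≈ t' → tens s t ≈ tens s' t'
  seq-cong   : ∀ {s s' t t'} → s ≈ s' → t ≈ t' → seq s t ≈ seq s' t'

data _⇝_ {A : Set} : Term A → Term A → Set where
  r1  : ∀ {X Y U V} → tens (par X Y) (par U V) ⇝ par (tens X U) (tens Y V)
  r2  : ∀ {X Y U}   → tens (par X Y) U ⇝ par (tens X U) Y
  r3  : ∀ {Y U}     → tens Y U ⇝ par U Y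
  r4  : ∀ {X Y U V} → tens (seq X Y) (seq U V) ⇝ seq (tens X U) (tens Y V)
  r5  : ∀ {X Y U}   → tens (seq X Y) U ⇝ seq (tens X U) Y
  r6  : ∀ {Y U V}   → tens Y (seq U V) ⇝ seq U (tens Y V)
  r7  : ∀ {Y U}     → tens Y U ⇝ seq U Y
  r8  : ∀ {X Y U V} → seq (par X Y) (par U V) ⇝ par (seq X U) (seq Y V)
  r9  : ∀ {X Y U}   → seq (par X Y) U ⇝ par (seq X U) Y
  r10 : ∀ {Y U V}   → seq Y (par U V) ⇝ par U (seq Y V)
  r11 : ∀ {Y U}     → seq Y U ⇝ par U Y
  par-l  : ∀ {s s' t} → s ⇝ s' → par s t ⇝ par s' t
  par-r  : ∀ {s t t'} → t ⇝ t' → par s t ⇝ par s t'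
  tens-l : ∀ {s s' t} → s ⇝ s' → tens s t ⇝ tens s' t
  tens-r : ∀ {s t t'} → t ⇝ t' → tens s t ⇝ tens s t'
  seq-l  : ∀ {s s' t} → s ⇝ s' → seq s t ⇝ seq s' t
  seq-r  : ∀ {s t t'} → t ⇝ t' → seq s t ⇝ seq s t'

data _≈⇝_ {A : Set} (s t : Term A) : Set where
  ac   : s ≈ t → s ≈⇝ t
  step : s ⇝ t → s ≈⇝ t

_⇝*_ : {A : Set} → Term A → Term A → Set
s ⇝* t = Star _≈⇝_ s t

-- Soundness: every rule and every AC-law only deletes edges and keeps the atoms, so a
-- rewrite sequence t ⇝* t' gives ⟦ t' ⟧ ⊆ ⟦ t ⟧.
-- Completeness goes by induction on the target t' = A' ∘ B' (∘ one of ⅋, ⊗, <). Split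
-- the source t into the parts t₁, t₂ lying over the atoms of A' and of B'. Bottom-up,
-- t rewrites to t₁ ∘ t₂: at each node an interchange law (a rule or an AC-law) moves
-- the split outwards, and the only nodes where no such law applies are those whose
-- split would create an edge of A' ∘ B' that is missing in t, which is excluded since
-- ⟦ A' ∘ B' ⟧ ⊆ ⟦ t ⟧. The parts t₁, t₂ again contain the edges of A', B', so by
-- induction they rewrite to A', B'.
module Submission where

open import Defs
open import Data.Nat using (ℕ)
open import Data.Fin using (Fin)
open import Data.Fin.Properties using (_≟_)
open import Data.Product using (_×_; Σ-syntax; _,_; proj₁; proj₂; swap)
open import Data.Sum using (_⊎_; inj₁; inj₂; [_,_]′; assocʳ; assocˡ)
import Data.Sum as Sum
open import Data.Empty using (⊥; ⊥-elim)
open import Data.Bool using (true; false; if_then_else_)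
open import Data.Maybe using (Maybe; just; nothing)
open import Data.Maybe.Relation.Binary.Pointwise as Pointwise using (Pointwise; just; nothing; drop-just)
open import Data.List using (List; []; _∷_; _++_; [_]; filter)
open import Data.List.Properties using (++-identityʳ; filter-++)
open import Data.List.Membership.Propositional using (_∈_; _∉_)
open import Data.List.Membership.Propositional.Properties
  using (∈-++⁺ˡ; ∈-++⁺ʳ; ∈-++⁻; ∈-filter⁺; ∈-filter⁻; ∈-allFin)
open import Data.List.Relation.Unary.Any using (here; there)
open import Data.List.Relation.Unary.All using (lookup)
open import Data.List.Relation.Unary.All.Properties using (++⁻ˡ)
open import Data.List.Relation.Unary.AllPairs using ([]; _∷_)
open import Data.List.Relation.Unary.Unique.Propositional using (Unique)
open import Data.List.Relation.Unary.Unique.Propositional.Properties using (allFin⁺; filter⁺)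
open import Data.List.Relation.Binary.Disjoint.Propositional using (Disjoint)
open import Data.List.Relation.Binary.Subset.Propositional using (_⊆_)
open import Data.List.Relation.Binary.Subset.Propositional.Properties using (⊆-reflexive-↭; ++⁺)
open import Data.List.Relation.Binary.Permutation.Propositional using (_↭_; ↭-sym; ↭-trans; ↭⇒↭ₛ)
import Data.List.Relation.Binary.Permutation.Propositional.Properties as ↭
import Data.List.Relation.Binary.Permutation.Setoid.Properties as ↭ₛ
open import Relation.Binary.PropositionalEquality
  using (_≡_; refl; sym; trans; cong₂; subst; setoid)
open import Relation.Binary.Construct.Closure.ReflexiveTransitive using (ε; _◅_; _◅◅_; gmap)
open import Relation.Binary.Core using (Rel; _⇒_)
open import Relation.Binary.Definitions using (DecidableEquality)
open import Relation.Nullary using (¬_; does)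
open import Relation.Unary using (Pred; Decidable; ∁)
open import Relation.Unary.Properties using (∁?)
open import Function using (_∘_)
open import Function.Bundles using (_⇔_; mk⇔)
open import Level using (0ℓ)

-- An edge of a composite lies in its first or second component, or goes across from the
-- first to the second (₁₂) or from the second to the first (₂₁).
pattern par₁ e = inj₁ e
pattern par₂ e = inj₂ e
pattern tens₁ e = inj₁ e
pattern tens₂ e = inj₂ (inj₁ e)
pattern tens₁₂ x∈ y∈ = inj₂ (inj₂ (inj₁ (x∈ , y∈)))
pattern tens₂₁ x∈ y∈ = inj₂ (inj₂ (inj₂ (x∈ , y∈)))
pattern seq₁ e = inj₁ e
pattern seq₂ e = inj₂ (inj₁ e)
pattern seq₁₂ x∈ y∈ = inj₂ (inj₂ (x∈ , y∈))

module _ {A : Set} where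

  some-atom : (t : Term A) → Σ[ x ∈ A ] x ∈ atoms t
  some-atom (leaf a)   = a , here refl
  some-atom (par s _)  = let x , x∈ = some-atom s in x , ∈-++⁺ˡ x∈
  some-atom (tens s _) = let x , x∈ = some-atom s in x , ∈-++⁺ˡ x∈
  some-atom (seq s _)  = let x , x∈ = some-atom s in x , ∈-++⁺ˡ x∈

  edge-atoms : ∀ (t : Term A) {x y} → ⟦ t ⟧ x y → x ∈ atoms t × y ∈ atoms t
  edge-atoms (par s u)  (par₁ e)       = let x∈ , y∈ = edge-atoms s e in ∈-++⁺ˡ x∈ , ∈-++⁺ˡ y∈
  edge-atoms (par s u)  (par₂ e)       = let x∈ , y∈ = edge-atoms u e in ∈-++⁺ʳ _ x∈ , ∈-++⁺ʳ _ y∈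
  edge-atoms (tens s u) (tens₁ e)      = let x∈ , y∈ = edge-atoms s e in ∈-++⁺ˡ x∈ , ∈-++⁺ˡ y∈
  edge-atoms (tens s u) (tens₂ e)      = let x∈ , y∈ = edge-atoms u e in ∈-++⁺ʳ _ x∈ , ∈-++⁺ʳ _ y∈
  edge-atoms (tens s u) (tens₁₂ x∈ y∈) = ∈-++⁺ˡ x∈ , ∈-++⁺ʳ _ y∈
  edge-atoms (tens s u) (tens₂₁ x∈ y∈) = ∈-++⁺ʳ _ x∈ , ∈-++⁺ˡ y∈
  edge-atoms (seq s u)  (seq₁ e)       = let x∈ , y∈ = edge-atoms s e in ∈-++⁺ˡ x∈ , ∈-++⁺ˡ y∈
  edge-atoms (seq s u)  (seq₂ e)       = let x∈ , y∈ = edge-atoms u e in ∈-++⁺ʳ _ x∈ , ∈-++⁺ʳ _ y∈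
  edge-atoms (seq s u)  (seq₁₂ x∈ y∈)  = ∈-++⁺ˡ x∈ , ∈-++⁺ʳ _ y∈

  Unique-++⁻ : ∀ (xs : List A) {ys} → Unique (xs ++ ys) → Unique xs × Unique ys × Disjoint xs ys
  Unique-++⁻ []       u          = [] , u , λ { (() , _) }
  Unique-++⁻ (x ∷ xs) (x∉ ∷ u) =
    let uxs , uys , disj = Unique-++⁻ xs u
    in ++⁻ˡ xs x∉ ∷ uxs , uys ,
       λ { (here refl , x∈ys) → lookup x∉ (∈-++⁺ʳ xs x∈ys) refl ; (there v∈xs , v∈ys) → disj (v∈xs , v∈ys) }

  ∈-++-∉ˡ : ∀ {xs ys : List A} {x} → x ∈ xs ++ ys → x ∉ xs → x ∈ ys
  ∈-++-∉ˡ {xs} x∈ x∉xs = [ (λ x∈xs → ⊥-elim (x∉xs x∈xs)) , (λ x∈ys → x∈ys) ]′ (∈-++⁻ xs x∈)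

  ++-medial : ∀ (xs ys us vs : List A) → (xs ++ ys) ++ (us ++ vs) ↭ (xs ++ us) ++ (ys ++ vs)
  ++-medial xs ys us vs =
    ↭-trans (↭.++-assoc xs ys (us ++ vs))
      (↭-trans (↭.++⁺ˡ xs (↭.shifts ys us)) (↭-sym (↭.++-assoc xs us (ys ++ vs))))

  ++-swapʳ : ∀ (xs ys zs : List A) → (xs ++ ys) ++ zs ↭ (xs ++ zs) ++ ys
  ++-swapʳ xs ys zs =
    ↭-trans (↭.++-assoc xs ys zs)
      (↭-trans (↭.++⁺ˡ xs (↭.++-comm ys zs)) (↭-sym (↭.++-assoc xs zs ys)))

-- Soundness

module _ {A : Set} where

  infix 4 _⊑_
  _⊑_ : Term A → Term A → Set
  s ⊑ t = atoms s ⊆ atoms t × ⟦ s ⟧ ⇒ ⟦ t ⟧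

  private
    ↭⇒⊆ : ∀ {xs ys : List A} → xs ↭ ys → xs ⊆ ys
    ↭⇒⊆ = ⊆-reflexive-↭

    case-∈-++ : ∀ (xs : List A) {ys x} {C : Set} → x ∈ xs ++ ys → (x ∈ xs → C) → (x ∈ ys → C) → C
    case-∈-++ xs x∈ f g = [ f , g ]′ (∈-++⁻ xs x∈)

    inˡ : ∀ {xs ys : List A} {x} → x ∈ xs → x ∈ xs ++ ys
    inˡ = ∈-++⁺ˡ

    inʳ : ∀ (xs : List A) {ys x} → x ∈ ys → x ∈ xs ++ ys
    inʳ xs = ∈-++⁺ʳ xs

  ⊑-refl : ∀ {s} → s ⊑ s
  ⊑-refl = (λ x∈ → x∈) , (λ e → e)

  ⊑-trans : ∀ {s t u} → s ⊑ t → t ⊑ u → s ⊑ u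
  ⊑-trans (as , es) (bs , fs) = bs ∘ as , fs ∘ es

  par-mono : ∀ {s s' u u'} → s ⊑ s' → u ⊑ u' → par s u ⊑ par s' u'
  par-mono (as , es) (au , eu) = ++⁺ as au , Sum.map es eu

  tens-mono : ∀ {s s' u u'} → s ⊑ s' → u ⊑ u' → tens s u ⊑ tens s' u'
  tens-mono (as , es) (au , eu) = ++⁺ as au ,
    λ { (tens₁ e) → tens₁ (es e) ; (tens₂ e) → tens₂ (eu e)
      ; (tens₁₂ x∈ y∈) → tens₁₂ (as x∈) (au y∈) ; (tens₂₁ x∈ y∈) → tens₂₁ (au x∈) (as y∈) }

  seq-mono : ∀ {s s' u u'} → s ⊑ s' → u ⊑ u' → seq s u ⊑ seq s' u'
  seq-mono (as , es) (au , eu) = ++⁺ as au ,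
    λ { (seq₁ e) → seq₁ (es e) ; (seq₂ e) → seq₂ (eu e) ; (seq₁₂ x∈ y∈) → seq₁₂ (as x∈) (au y∈) }

  tens-assocʳ : ∀ {s t u} → tens (tens s t) u ⊑ tens s (tens t u)
  tens-assocʳ {s} {t} {u} = ↭⇒⊆ (↭.++-assoc (atoms s) (atoms t) (atoms u)) ,
    λ { (tens₁ (tens₁ e)) → tens₁ e ; (tens₁ (tens₂ e)) → tens₂ (tens₁ e)
      ; (tens₁ (tens₁₂ x∈ y∈)) → tens₁₂ x∈ (inˡ y∈) ; (tens₁ (tens₂₁ x∈ y∈)) → tens₂₁ (inˡ x∈) y∈
      ; (tens₂ e) → tens₂ (tens₂ e)
      ; (tens₁₂ x∈ y∈) → case-∈-++ (atoms s) x∈ (λ x∈s → tens₁₂ x∈s (inʳ (atoms t) y∈)) (λ x∈t → tens₂ (tens₁₂ x∈t y∈))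
      ; (tens₂₁ x∈ y∈) → case-∈-++ (atoms s) y∈ (λ y∈s → tens₂₁ (inʳ (atoms t) x∈) y∈s) (λ y∈t → tens₂ (tens₂₁ x∈ y∈t)) }

  tens-assocˡ : ∀ {s t u} → tens s (tens t u) ⊑ tens (tens s t) u
  tens-assocˡ {s} {t} {u} = ↭⇒⊆ (↭-sym (↭.++-assoc (atoms s) (atoms t) (atoms u))) ,
    λ { (tens₁ e) → tens₁ (tens₁ e) ; (tens₂ (tens₁ e)) → tens₁ (tens₂ e) ; (tens₂ (tens₂ e)) → tens₂ e
      ; (tens₂ (tens₁₂ x∈ y∈)) → tens₁₂ (inʳ (atoms s) x∈) y∈ ; (tens₂ (tens₂₁ x∈ y∈)) → tens₂₁ x∈ (inʳ (atoms s) y∈)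
      ; (tens₁₂ x∈ y∈) → case-∈-++ (atoms t) y∈ (λ y∈t → tens₁ (tens₁₂ x∈ y∈t)) (λ y∈u → tens₁₂ (inˡ x∈) y∈u)
      ; (tens₂₁ x∈ y∈) → case-∈-++ (atoms t) x∈ (λ x∈t → tens₁ (tens₂₁ x∈t y∈)) (λ x∈u → tens₂₁ x∈u (inˡ y∈)) }

  seq-assocʳ : ∀ {s t u} → seq (seq s t) u ⊑ seq s (seq t u)
  seq-assocʳ {s} {t} {u} = ↭⇒⊆ (↭.++-assoc (atoms s) (atoms t) (atoms u)) ,
    λ { (seq₁ (seq₁ e)) → seq₁ e ; (seq₁ (seq₂ e)) → seq₂ (seq₁ e) ; (seq₁ (seq₁₂ x∈ y∈)) → seq₁₂ x∈ (inˡ y∈)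
      ; (seq₂ e) → seq₂ (seq₂ e)
      ; (seq₁₂ x∈ y∈) → case-∈-++ (atoms s) x∈ (λ x∈s → seq₁₂ x∈s (inʳ (atoms t) y∈)) (λ x∈t → seq₂ (seq₁₂ x∈t y∈)) }

  seq-assocˡ : ∀ {s t u} → seq s (seq t u) ⊑ seq (seq s t) u
  seq-assocˡ {s} {t} {u} = ↭⇒⊆ (↭-sym (↭.++-assoc (atoms s) (atoms t) (atoms u))) ,
    λ { (seq₁ e) → seq₁ (seq₁ e) ; (seq₂ (seq₁ e)) → seq₁ (seq₂ e) ; (seq₂ (seq₂ e)) → seq₂ e
      ; (seq₂ (seq₁₂ x∈ y∈)) → seq₁₂ (inʳ (atoms s) x∈) y∈
      ; (seq₁₂ x∈ y∈) → case-∈-++ (atoms t) y∈ (λ y∈t → seq₁ (seq₁₂ x∈ y∈t)) (λ y∈u → seq₁₂ (inˡ x∈) y∈u) }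

  ≈⇒⊑ : ∀ {s t} → s ≈ t → s ⊑ t × t ⊑ s
  ≈⇒⊑ ≈-refl        = ⊑-refl , ⊑-refl
  ≈⇒⊑ (≈-sym e)     = swap (≈⇒⊑ e)
  ≈⇒⊑ (≈-trans e f) = let st , ts = ≈⇒⊑ e ; tu , ut = ≈⇒⊑ f in ⊑-trans st tu , ⊑-trans ut ts
  ≈⇒⊑ (par-assoc {s} {t} {u}) =
    (↭⇒⊆ (↭.++-assoc (atoms s) (atoms t) (atoms u)) , assocʳ) ,
    (↭⇒⊆ (↭-sym (↭.++-assoc (atoms s) (atoms t) (atoms u))) , assocˡ)
  ≈⇒⊑ tens-assoc    = tens-assocʳ , tens-assocˡ
  ≈⇒⊑ seq-assoc     = seq-assocʳ , seq-assocˡ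
  ≈⇒⊑ (par-comm {s} {t}) = (↭⇒⊆ (↭.++-comm (atoms s) (atoms t)) , Sum.swap) ,
                           (↭⇒⊆ (↭.++-comm (atoms t) (atoms s)) , Sum.swap)
  ≈⇒⊑ (tens-comm {s} {t}) = tens-comm-⊑ , tens-comm-⊑
    where
      tens-comm-⊑ : ∀ {s t} → tens s t ⊑ tens t s
      tens-comm-⊑ {s} {t} = ↭⇒⊆ (↭.++-comm (atoms s) (atoms t)) ,
        λ { (tens₁ e) → tens₂ e ; (tens₂ e) → tens₁ e ; (tens₁₂ x∈ y∈) → tens₂₁ x∈ y∈ ; (tens₂₁ x∈ y∈) → tens₁₂ x∈ y∈ }
  ≈⇒⊑ (par-cong e f)  = let ss , s's = ≈⇒⊑ e ; tt , t't = ≈⇒⊑ f in par-mono ss tt , par-mono s's t't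
  ≈⇒⊑ (tens-cong e f) = let ss , s's = ≈⇒⊑ e ; tt , t't = ≈⇒⊑ f in tens-mono ss tt , tens-mono s's t't
  ≈⇒⊑ (seq-cong e f)  = let ss , s's = ≈⇒⊑ e ; tt , t't = ≈⇒⊑ f in seq-mono ss tt , seq-mono s's t't

  ⇝⇒⊒ : ∀ {s t} → s ⇝ t → t ⊑ s
  ⇝⇒⊒ (r1 {X} {Y} {U} {V}) = ↭⇒⊆ (++-medial (atoms X) (atoms U) (atoms Y) (atoms V)) ,
    λ { (par₁ (tens₁ e)) → tens₁ (par₁ e) ; (par₁ (tens₂ e)) → tens₂ (par₁ e)
      ; (par₁ (tens₁₂ x∈ y∈)) → tens₁₂ (inˡ x∈) (inˡ y∈) ; (par₁ (tens₂₁ x∈ y∈)) → tens₂₁ (inˡ x∈) (inˡ y∈)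
      ; (par₂ (tens₁ e)) → tens₁ (par₂ e) ; (par₂ (tens₂ e)) → tens₂ (par₂ e)
      ; (par₂ (tens₁₂ x∈ y∈)) → tens₁₂ (inʳ (atoms X) x∈) (inʳ (atoms U) y∈)
      ; (par₂ (tens₂₁ x∈ y∈)) → tens₂₁ (inʳ (atoms U) x∈) (inʳ (atoms X) y∈) }
  ⇝⇒⊒ (r2 {X} {Y} {U}) = ↭⇒⊆ (++-swapʳ (atoms X) (atoms U) (atoms Y)) ,
    λ { (par₁ (tens₁ e)) → tens₁ (par₁ e) ; (par₁ (tens₂ e)) → tens₂ e
      ; (par₁ (tens₁₂ x∈ y∈)) → tens₁₂ (inˡ x∈) y∈ ; (par₁ (tens₂₁ x∈ y∈)) → tens₂₁ x∈ (inˡ y∈)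
      ; (par₂ e) → tens₁ (par₂ e) }
  ⇝⇒⊒ (r3 {Y} {U}) = ↭⇒⊆ (↭.++-comm (atoms U) (atoms Y)) ,
    λ { (par₁ e) → tens₂ e ; (par₂ e) → tens₁ e }
  ⇝⇒⊒ (r4 {X} {Y} {U} {V}) = ↭⇒⊆ (++-medial (atoms X) (atoms U) (atoms Y) (atoms V)) ,
    λ { (seq₁ (tens₁ e)) → tens₁ (seq₁ e) ; (seq₁ (tens₂ e)) → tens₂ (seq₁ e)
      ; (seq₁ (tens₁₂ x∈ y∈)) → tens₁₂ (inˡ x∈) (inˡ y∈) ; (seq₁ (tens₂₁ x∈ y∈)) → tens₂₁ (inˡ x∈) (inˡ y∈)
      ; (seq₂ (tens₁ e)) → tens₁ (seq₂ e) ; (seq₂ (tens₂ e)) → tens₂ (seq₂ e)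
      ; (seq₂ (tens₁₂ x∈ y∈)) → tens₁₂ (inʳ (atoms X) x∈) (inʳ (atoms U) y∈)
      ; (seq₂ (tens₂₁ x∈ y∈)) → tens₂₁ (inʳ (atoms U) x∈) (inʳ (atoms X) y∈)
      ; (seq₁₂ x∈ y∈) → case-∈-++ (atoms X) x∈
          (λ x∈X → case-∈-++ (atoms Y) y∈ (λ y∈Y → tens₁ (seq₁₂ x∈X y∈Y)) (λ y∈V → tens₁₂ (inˡ x∈X) (inʳ (atoms U) y∈V)))
          (λ x∈U → case-∈-++ (atoms Y) y∈ (λ y∈Y → tens₂₁ (inˡ x∈U) (inʳ (atoms X) y∈Y)) (λ y∈V → tens₂ (seq₁₂ x∈U y∈V))) }
  ⇝⇒⊒ (r5 {X} {Y} {U}) = ↭⇒⊆ (++-swapʳ (atoms X) (atoms U) (atoms Y)) ,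
    λ { (seq₁ (tens₁ e)) → tens₁ (seq₁ e) ; (seq₁ (tens₂ e)) → tens₂ e
      ; (seq₁ (tens₁₂ x∈ y∈)) → tens₁₂ (inˡ x∈) y∈ ; (seq₁ (tens₂₁ x∈ y∈)) → tens₂₁ x∈ (inˡ y∈)
      ; (seq₂ e) → tens₁ (seq₂ e)
      ; (seq₁₂ x∈ y∈) → case-∈-++ (atoms X) x∈ (λ x∈X → tens₁ (seq₁₂ x∈X y∈)) (λ x∈U → tens₂₁ x∈U (inʳ (atoms X) y∈)) }
  ⇝⇒⊒ (r6 {Y} {U} {V}) = ↭⇒⊆ (↭.shifts (atoms U) (atoms Y)) ,
    λ { (seq₁ e) → tens₂ (seq₁ e) ; (seq₂ (tens₁ e)) → tens₁ e ; (seq₂ (tens₂ e)) → tens₂ (seq₂ e)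
      ; (seq₂ (tens₁₂ x∈ y∈)) → tens₁₂ x∈ (inʳ (atoms U) y∈) ; (seq₂ (tens₂₁ x∈ y∈)) → tens₂₁ (inʳ (atoms U) x∈) y∈
      ; (seq₁₂ x∈ y∈) → case-∈-++ (atoms Y) y∈ (λ y∈Y → tens₂₁ (inˡ x∈) y∈Y) (λ y∈V → tens₂ (seq₁₂ x∈ y∈V)) }
  ⇝⇒⊒ (r7 {Y} {U}) = ↭⇒⊆ (↭.++-comm (atoms U) (atoms Y)) ,
    λ { (seq₁ e) → tens₂ e ; (seq₂ e) → tens₁ e ; (seq₁₂ x∈ y∈) → tens₂₁ x∈ y∈ }
  ⇝⇒⊒ (r8 {X} {Y} {U} {V}) = ↭⇒⊆ (++-medial (atoms X) (atoms U) (atoms Y) (atoms V)) ,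
    λ { (par₁ (seq₁ e)) → seq₁ (par₁ e) ; (par₁ (seq₂ e)) → seq₂ (par₁ e)
      ; (par₁ (seq₁₂ x∈ y∈)) → seq₁₂ (inˡ x∈) (inˡ y∈)
      ; (par₂ (seq₁ e)) → seq₁ (par₂ e) ; (par₂ (seq₂ e)) → seq₂ (par₂ e)
      ; (par₂ (seq₁₂ x∈ y∈)) → seq₁₂ (inʳ (atoms X) x∈) (inʳ (atoms U) y∈) }
  ⇝⇒⊒ (r9 {X} {Y} {U}) = ↭⇒⊆ (++-swapʳ (atoms X) (atoms U) (atoms Y)) ,
    λ { (par₁ (seq₁ e)) → seq₁ (par₁ e) ; (par₁ (seq₂ e)) → seq₂ e
      ; (par₁ (seq₁₂ x∈ y∈)) → seq₁₂ (inˡ x∈) y∈ ; (par₂ e) → seq₁ (par₂ e) }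
  ⇝⇒⊒ (r10 {Y} {U} {V}) = ↭⇒⊆ (↭.shifts (atoms U) (atoms Y)) ,
    λ { (par₁ e) → seq₂ (par₁ e) ; (par₂ (seq₁ e)) → seq₁ e ; (par₂ (seq₂ e)) → seq₂ (par₂ e)
      ; (par₂ (seq₁₂ x∈ y∈)) → seq₁₂ x∈ (inʳ (atoms U) y∈) }
  ⇝⇒⊒ (r11 {Y} {U}) = ↭⇒⊆ (↭.++-comm (atoms U) (atoms Y)) ,
    λ { (par₁ e) → seq₂ e ; (par₂ e) → seq₁ e }
  ⇝⇒⊒ (par-l r)  = par-mono (⇝⇒⊒ r) ⊑-refl
  ⇝⇒⊒ (par-r r)  = par-mono ⊑-refl (⇝⇒⊒ r)
  ⇝⇒⊒ (tens-l r) = tens-mono (⇝⇒⊒ r) ⊑-refl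
  ⇝⇒⊒ (tens-r r) = tens-mono ⊑-refl (⇝⇒⊒ r)
  ⇝⇒⊒ (seq-l r)  = seq-mono (⇝⇒⊒ r) ⊑-refl
  ⇝⇒⊒ (seq-r r)  = seq-mono ⊑-refl (⇝⇒⊒ r)

  ⇝*⇒⊒ : ∀ {s t} → s ⇝* t → t ⊑ s
  ⇝*⇒⊒ ε                = ⊑-refl
  ⇝*⇒⊒ (ac e   ◅ steps) = ⊑-trans (⇝*⇒⊒ steps) (proj₂ (≈⇒⊑ e))
  ⇝*⇒⊒ (step r ◅ steps) = ⊑-trans (⇝*⇒⊒ steps) (⇝⇒⊒ r)

module _ {A : Set} where

  ≈⇒⇝* : ∀ {s t : Term A} → s ≈ t → s ⇝* t
  ≈⇒⇝* e = ac e ◅ ε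

  ⇝⇒⇝* : ∀ {s t : Term A} → s ⇝ t → s ⇝* t
  ⇝⇒⇝* r = step r ◅ ε

  par* : ∀ {s s' u u' : Term A} → s ⇝* s' → u ⇝* u' → par s u ⇝* par s' u'
  par* {s' = s'} {u} p q = gmap (λ a → par a u) left p ◅◅ gmap (par s') right q
    where
      left : ∀ {a b} → a ≈⇝ b → par a u ≈⇝ par b u
      left (ac e)   = ac (par-cong e ≈-refl)
      left (step r) = step (par-l r)
      right : ∀ {a b} → a ≈⇝ b → par s' a ≈⇝ par s' b
      right (ac e)   = ac (par-cong ≈-refl e)
      right (step r) = step (par-r r)

  tens* : ∀ {s s' u u' : Term A} → s ⇝* s' → u ⇝* u' → tens s u ⇝* tens s' u'
  tens* {s' = s'} {u} p q = gmap (λ a → tens a u) left p ◅◅ gmap (tens s') right q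
    where
      left : ∀ {a b} → a ≈⇝ b → tens a u ≈⇝ tens b u
      left (ac e)   = ac (tens-cong e ≈-refl)
      left (step r) = step (tens-l r)
      right : ∀ {a b} → a ≈⇝ b → tens s' a ≈⇝ tens s' b
      right (ac e)   = ac (tens-cong ≈-refl e)
      right (step r) = step (tens-r r)

  seq* : ∀ {s s' u u' : Term A} → s ⇝* s' → u ⇝* u' → seq s u ⇝* seq s' u'
  seq* {s' = s'} {u} p q = gmap (λ a → seq a u) left p ◅◅ gmap (seq s') right q
    where
      left : ∀ {a b} → a ≈⇝ b → seq a u ≈⇝ seq b u
      left (ac e)   = ac (seq-cong e ≈-refl)
      left (step r) = step (seq-l r)
      right : ∀ {a b} → a ≈⇝ b → seq s' a ≈⇝ seq s' b
      right (ac e)   = ac (seq-cong ≈-refl e)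
      right (step r) = step (seq-r r)

-- nothing stands for the empty term, which is a unit for every composition.
module _ {A : Set} where

  atoms? : Maybe (Term A) → List A
  atoms? (just t) = atoms t
  atoms? nothing  = []

  ⟦_⟧? : Maybe (Term A) → A → A → Set
  ⟦ just t ⟧? = ⟦ t ⟧
  ⟦ nothing ⟧? _ _ = ⊥

  join : (Term A → Term A → Term A) → Maybe (Term A) → Maybe (Term A) → Maybe (Term A)
  join g (just s) (just u) = just (g s u)
  join g (just s) nothing  = just s
  join g nothing  n        = n

  infix 4 _⇝?_
  _⇝?_ : Maybe (Term A) → Maybe (Term A) → Set
  _⇝?_ = Pointwise _⇝*_

  ⇝?-refl : ∀ {m} → m ⇝? m
  ⇝?-refl = Pointwise.refl ε

  ⇝?-trans : ∀ {m n o} → m ⇝? n → n ⇝? o → m ⇝? o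
  ⇝?-trans = Pointwise.trans _◅◅_

  ≡⇒⇝? : ∀ {m n} → m ≡ n → m ⇝? n
  ≡⇒⇝? refl = ⇝?-refl

  join-cong : ∀ {g} → (∀ {s s' u u'} → s ⇝* s' → u ⇝* u' → g s u ⇝* g s' u') →
              ∀ {m m' n n'} → m ⇝? m' → n ⇝? n' → join g m n ⇝? join g m' n'
  join-cong g* (just p) (just q) = just (g* p q)
  join-cong g* (just p) nothing  = just p
  join-cong g* nothing  q        = q

  atoms-join : ∀ {g} → (∀ s u → atoms (g s u) ≡ atoms s ++ atoms u) →
               ∀ m n → atoms? (join g m n) ≡ atoms? m ++ atoms? n
  atoms-join g-atoms (just s) (just u) = g-atoms s u
  atoms-join g-atoms (just s) nothing  = sym (++-identityʳ (atoms s))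
  atoms-join g-atoms nothing  n        = refl

  join-par⁺ : ∀ m n {x y} → ⟦ m ⟧? x y ⊎ ⟦ n ⟧? x y → ⟦ join par m n ⟧? x y
  join-par⁺ (just s) (just u) e        = e
  join-par⁺ (just s) nothing (par₁ e)  = e
  join-par⁺ (just s) nothing (par₂ ())
  join-par⁺ nothing  n       (par₁ ())
  join-par⁺ nothing  n       (par₂ e)  = e

  join-tens⁺ : ∀ m n {x y} →
    ⟦ m ⟧? x y ⊎ ⟦ n ⟧? x y ⊎ (x ∈ atoms? m × y ∈ atoms? n) ⊎ (x ∈ atoms? n × y ∈ atoms? m) →
    ⟦ join tens m n ⟧? x y
  join-tens⁺ (just s) (just u) e            = e
  join-tens⁺ (just s) nothing (tens₁ e)     = e
  join-tens⁺ (just s) nothing (tens₂ ())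
  join-tens⁺ (just s) nothing (tens₁₂ _ ())
  join-tens⁺ (just s) nothing (tens₂₁ () _)
  join-tens⁺ nothing  n       (tens₁ ())
  join-tens⁺ nothing  n       (tens₂ e)     = e
  join-tens⁺ nothing  n       (tens₁₂ () _)
  join-tens⁺ nothing  n       (tens₂₁ _ ())

  join-seq⁺ : ∀ m n {x y} →
    ⟦ m ⟧? x y ⊎ ⟦ n ⟧? x y ⊎ (x ∈ atoms? m × y ∈ atoms? n) → ⟦ join seq m n ⟧? x y
  join-seq⁺ (just s) (just u) e          = e
  join-seq⁺ (just s) nothing (seq₁ e)    = e
  join-seq⁺ (just s) nothing (seq₂ ())
  join-seq⁺ (just s) nothing (seq₁₂ _ ())
  join-seq⁺ nothing  n       (seq₁ ())
  join-seq⁺ nothing  n       (seq₂ e)    = e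
  join-seq⁺ nothing  n       (seq₁₂ () _)

  Exclusive : Maybe (Term A) → Maybe (Term A) → Set
  Exclusive m n = ∀ {x y} → x ∈ atoms? m → y ∈ atoms? n → ⊥

  Exclusive-sym : ∀ {m n} → Exclusive m n → Exclusive n m
  Exclusive-sym excl y∈ x∈ = excl x∈ y∈

  ¬Exclusive-just : ∀ {s u} → ¬ Exclusive (just s) (just u)
  ¬Exclusive-just {s} {u} excl = excl (proj₂ (some-atom s)) (proj₂ (some-atom u))

-- Interchange laws

record Interchange {A : Set} (g h : Term A → Term A → Term A) : Set where
  field
    interchange : ∀ {s₁ s₂ u₁ u₂} → g (h s₁ s₂) (h u₁ u₂) ⇝* h (g s₁ u₁) (g s₂ u₂)
    without-s₁  : ∀ {s₂ u₁ u₂} → g s₂ (h u₁ u₂) ⇝* h u₁ (g s₂ u₂)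
    without-s₂  : ∀ {s₁ u₁ u₂} → g s₁ (h u₁ u₂) ⇝* h (g s₁ u₁) u₂
    without-u₁  : ∀ {s₁ s₂ u₂} → g (h s₁ s₂) u₂ ⇝* h s₁ (g s₂ u₂)
    without-u₂  : ∀ {s₁ s₂ u₁} → g (h s₁ s₂) u₁ ⇝* h (g s₁ u₁) s₂
    switch      : ∀ {s₁ u₂} → g s₁ u₂ ⇝* h s₁ u₂
    switch˘     : ∀ {s₂ u₁} → g s₂ u₁ ⇝* h u₁ s₂

module _ {A : Set} {g h : Term A → Term A → Term A} where

  interchange? : Interchange g h → ∀ s₁ s₂ u₁ u₂ →
    join g (join h s₁ s₂) (join h u₁ u₂) ⇝? join h (join g s₁ u₁) (join g s₂ u₂)
  interchange? I nothing   nothing   u₁         u₂         = ⇝?-refl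
  interchange? I (just s₁) nothing   nothing    nothing    = ⇝?-refl
  interchange? I nothing   (just s₂) nothing    nothing    = ⇝?-refl
  interchange? I (just s₁) (just s₂) nothing    nothing    = ⇝?-refl
  interchange? I (just s₁) nothing   (just u₁)  nothing    = ⇝?-refl
  interchange? I nothing   (just s₂) nothing    (just u₂)  = ⇝?-refl
  interchange? I (just s₁) nothing   nothing    (just u₂)  = just (Interchange.switch I)
  interchange? I nothing   (just s₂) (just u₁)  nothing    = just (Interchange.switch˘ I)
  interchange? I (just s₁) nothing   (just u₁)  (just u₂)  = just (Interchange.without-s₂ I)
  interchange? I nothing   (just s₂) (just u₁)  (just u₂)  = just (Interchange.without-s₁ I)
  interchange? I (just s₁) (just s₂) (just u₁)  nothing    = just (Interchange.without-u₂ I)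
  interchange? I (just s₁) (just s₂) nothing    (just u₂)  = just (Interchange.without-u₁ I)
  interchange? I (just s₁) (just s₂) (just u₁)  (just u₂)  = just (Interchange.interchange I)

  interchange-exclusive : ∀ s₁ s₂ u₁ u₂ → Exclusive s₁ u₂ → Exclusive u₁ s₂ →
    join g (join h s₁ s₂) (join h u₁ u₂) ≡ join h (join g s₁ u₁) (join g s₂ u₂)
  interchange-exclusive nothing   nothing   u₁        u₂        _    _    = refl
  interchange-exclusive (just s₁) s₂        u₁        (just u₂) excl _    = ⊥-elim (¬Exclusive-just {s = s₁} {u = u₂} excl)
  interchange-exclusive s₁        (just s₂) (just u₁) u₂        _    excl = ⊥-elim (¬Exclusive-just {s = u₁} {u = s₂} excl)
  interchange-exclusive (just s₁) nothing   nothing   nothing   _    _    = refl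
  interchange-exclusive nothing   (just s₂) nothing   nothing   _    _    = refl
  interchange-exclusive (just s₁) (just s₂) nothing   nothing   _    _    = refl
  interchange-exclusive (just s₁) nothing   (just u₁) nothing   _    _    = refl
  interchange-exclusive nothing   (just s₂) nothing   (just u₂) _    _    = refl

module _ {A : Set} where

  interchange-seq : ∀ (s₁ s₂ u₁ u₂ : Maybe (Term A)) → Exclusive u₁ s₂ →
    join seq (join seq s₁ s₂) (join seq u₁ u₂) ⇝? join seq (join seq s₁ u₁) (join seq s₂ u₂)
  interchange-seq s₁        (just s₂) (just u₁) u₂        excl = ⊥-elim (¬Exclusive-just {s = u₁} {u = s₂} excl)
  interchange-seq nothing   nothing   u₁        u₂        _    = ⇝?-refl
  interchange-seq (just s₁) nothing   nothing   nothing   _    = ⇝?-refl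
  interchange-seq (just s₁) nothing   nothing   (just u₂) _    = ⇝?-refl
  interchange-seq (just s₁) nothing   (just u₁) nothing   _    = ⇝?-refl
  interchange-seq (just s₁) nothing   (just u₁) (just u₂) _    = just (≈⇒⇝* (≈-sym seq-assoc))
  interchange-seq nothing   (just s₂) nothing   u₂        _    = ⇝?-refl
  interchange-seq (just s₁) (just s₂) nothing   nothing   _    = ⇝?-refl
  interchange-seq (just s₁) (just s₂) nothing   (just u₂) _    = just (≈⇒⇝* seq-assoc)

  interchange-AC : ∀ {f : Term A → Term A → Term A} →
    (∀ {a b c} → f (f a b) c ≈ f a (f b c)) → (∀ {a b} → f a b ≈ f b a) →
    (∀ {a a' b b'} → a ≈ a' → b ≈ b' → f a b ≈ f a' b') → Interchange f f
  interchange-AC {f} assoc comm cong = record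
    { interchange = ≈⇒⇝* (≈-trans assoc (≈-trans (cong ≈-refl left-comm) (≈-sym assoc)))
    ; without-s₁  = ≈⇒⇝* left-comm
    ; without-s₂  = ≈⇒⇝* (≈-sym assoc)
    ; without-u₁  = ≈⇒⇝* assoc
    ; without-u₂  = ≈⇒⇝* (≈-trans assoc (≈-trans (cong ≈-refl comm) (≈-sym assoc)))
    ; switch      = ε
    ; switch˘     = ≈⇒⇝* comm
    }
    where
      left-comm : ∀ {a b c} → f a (f b c) ≈ f b (f a c)
      left-comm = ≈-trans (≈-sym assoc) (≈-trans (cong comm ≈-refl) assoc)

  par-par : Interchange {A} par par
  par-par = interchange-AC par-assoc par-comm par-cong

  tens-tens : Interchange {A} tens tens
  tens-tens = interchange-AC tens-assoc tens-comm tens-cong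

  tens-par : Interchange {A} tens par
  tens-par = record
    { interchange = ⇝⇒⇝* r1
    ; without-s₁  = ≈⇒⇝* (≈-trans tens-comm (tens-cong par-comm ≈-refl)) ◅◅ ⇝⇒⇝* r2
                      ◅◅ ≈⇒⇝* (≈-trans par-comm (par-cong ≈-refl tens-comm))
    ; without-s₂  = ≈⇒⇝* tens-comm ◅◅ ⇝⇒⇝* r2 ◅◅ ≈⇒⇝* (par-cong tens-comm ≈-refl)
    ; without-u₁  = ≈⇒⇝* (tens-cong par-comm ≈-refl) ◅◅ ⇝⇒⇝* r2 ◅◅ ≈⇒⇝* par-comm
    ; without-u₂  = ⇝⇒⇝* r2
    ; switch      = ⇝⇒⇝* r3 ◅◅ ≈⇒⇝* par-comm
    ; switch˘     = ⇝⇒⇝* r3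
    }

  seq-par : Interchange {A} seq par
  seq-par = record
    { interchange = ⇝⇒⇝* r8
    ; without-s₁  = ⇝⇒⇝* r10
    ; without-s₂  = ≈⇒⇝* (seq-cong ≈-refl par-comm) ◅◅ ⇝⇒⇝* r10 ◅◅ ≈⇒⇝* par-comm
    ; without-u₁  = ≈⇒⇝* (seq-cong par-comm ≈-refl) ◅◅ ⇝⇒⇝* r9 ◅◅ ≈⇒⇝* par-comm
    ; without-u₂  = ⇝⇒⇝* r9
    ; switch      = ⇝⇒⇝* r11 ◅◅ ≈⇒⇝* par-comm
    ; switch˘     = ⇝⇒⇝* r11
    }

  tens-seq : Interchange {A} tens seq
  tens-seq = record
    { interchange = ⇝⇒⇝* r4
    ; without-s₁  = ⇝⇒⇝* r6
    ; without-s₂  = ≈⇒⇝* tens-comm ◅◅ ⇝⇒⇝* r5 ◅◅ ≈⇒⇝* (seq-cong tens-comm ≈-refl)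
    ; without-u₁  = ≈⇒⇝* tens-comm ◅◅ ⇝⇒⇝* r6 ◅◅ ≈⇒⇝* (seq-cong ≈-refl tens-comm)
    ; without-u₂  = ⇝⇒⇝* r5
    ; switch      = ≈⇒⇝* tens-comm ◅◅ ⇝⇒⇝* r7
    ; switch˘     = ⇝⇒⇝* r7
    }

module _ {A : Set} {P : Pred A 0ℓ} (P? : Decidable P) where

  restrict : Term A → Maybe (Term A)
  restrict (leaf a)   = if does (P? a) then just (leaf a) else nothing
  restrict (par s u)  = join par  (restrict s) (restrict u)
  restrict (tens s u) = join tens (restrict s) (restrict u)
  restrict (seq s u)  = join seq  (restrict s) (restrict u)

  private
    atoms-restrict-node : ∀ {g} → (∀ s u → atoms (g s u) ≡ atoms s ++ atoms u) → ∀ s u →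
      atoms? (restrict s) ≡ filter P? (atoms s) → atoms? (restrict u) ≡ filter P? (atoms u) →
      atoms? (join g (restrict s) (restrict u)) ≡ filter P? (atoms s ++ atoms u)
    atoms-restrict-node g-atoms s u s≡ u≡ =
      trans (atoms-join g-atoms (restrict s) (restrict u))
            (trans (cong₂ _++_ s≡ u≡) (sym (filter-++ P? (atoms s) (atoms u))))

  atoms-restrict : ∀ t → atoms? (restrict t) ≡ filter P? (atoms t)
  atoms-restrict (leaf a) with does (P? a)
  ... | true  = refl
  ... | false = refl
  atoms-restrict (par s u)  = atoms-restrict-node {g = par} (λ _ _ → refl) s u (atoms-restrict s) (atoms-restrict u)
  atoms-restrict (tens s u) = atoms-restrict-node {g = tens} (λ _ _ → refl) s u (atoms-restrict s) (atoms-restrict u)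
  atoms-restrict (seq s u)  = atoms-restrict-node {g = seq} (λ _ _ → refl) s u (atoms-restrict s) (atoms-restrict u)

  ∈-restrict⁺ : ∀ t {x} → x ∈ atoms t → P x → x ∈ atoms? (restrict t)
  ∈-restrict⁺ t x∈ px = subst (_ ∈_) (sym (atoms-restrict t)) (∈-filter⁺ P? x∈ px)

  ∈-restrict⁻ : ∀ t {x} → x ∈ atoms? (restrict t) → x ∈ atoms t × P x
  ∈-restrict⁻ t x∈ = ∈-filter⁻ P? (subst (_ ∈_) (atoms-restrict t) x∈)

  Unique-restrict : ∀ t → Unique (atoms t) → Unique (atoms? (restrict t))
  Unique-restrict t u = subst Unique (sym (atoms-restrict t)) (filter⁺ P? u)

  restrict-edges : ∀ t {x y} → ⟦ t ⟧ x y → P x → P y → ⟦ restrict t ⟧? x y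
  restrict-edges (par s u) (par₁ e) px py = join-par⁺ (restrict s) (restrict u) (par₁ (restrict-edges s e px py))
  restrict-edges (par s u) (par₂ e) px py = join-par⁺ (restrict s) (restrict u) (par₂ (restrict-edges u e px py))
  restrict-edges (tens s u) (tens₁ e) px py = join-tens⁺ (restrict s) (restrict u) (tens₁ (restrict-edges s e px py))
  restrict-edges (tens s u) (tens₂ e) px py = join-tens⁺ (restrict s) (restrict u) (tens₂ (restrict-edges u e px py))
  restrict-edges (tens s u) (tens₁₂ x∈ y∈) px py =
    join-tens⁺ (restrict s) (restrict u) (tens₁₂ (∈-restrict⁺ s x∈ px) (∈-restrict⁺ u y∈ py))
  restrict-edges (tens s u) (tens₂₁ x∈ y∈) px py =
    join-tens⁺ (restrict s) (restrict u) (tens₂₁ (∈-restrict⁺ u x∈ px) (∈-restrict⁺ s y∈ py))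
  restrict-edges (seq s u) (seq₁ e) px py = join-seq⁺ (restrict s) (restrict u) (seq₁ (restrict-edges s e px py))
  restrict-edges (seq s u) (seq₂ e) px py = join-seq⁺ (restrict s) (restrict u) (seq₂ (restrict-edges u e px py))
  restrict-edges (seq s u) (seq₁₂ x∈ y∈) px py =
    join-seq⁺ (restrict s) (restrict u) (seq₁₂ (∈-restrict⁺ s x∈ px) (∈-restrict⁺ u y∈ py))

-- Splitting a term along a decidable set of atoms

module _ {A : Set} where

  Linked : Pred A 0ℓ → Pred A 0ℓ → Term A → Set
  Linked Q R t = ∀ {x y} → x ∈ atoms t → y ∈ atoms t → Q x → R y → ⟦ t ⟧ x y

  Linked-sub : ∀ {Q R s t} → atoms s ⊆ atoms t →
    (∀ {x y} → x ∈ atoms s → y ∈ atoms s → ⟦ t ⟧ x y → ⟦ s ⟧ x y) → Linked Q R t → Linked Q R s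
  Linked-sub s⊆t inner linked x∈ y∈ qx ry = inner x∈ y∈ (linked (s⊆t x∈) (s⊆t y∈) qx ry)

  Linked⇒Exclusive : ∀ {Q R} (Q? : Decidable Q) (R? : Decidable R) {s u t} →
    atoms s ⊆ atoms t → atoms u ⊆ atoms t → (∀ {x y} → x ∈ atoms s → y ∈ atoms u → ¬ ⟦ t ⟧ x y) →
    Linked Q R t → Exclusive (restrict Q? s) (restrict R? u)
  Linked⇒Exclusive Q? R? {s} {u} s⊆t u⊆t no-edge linked x∈ y∈ =
    let x∈s , qx = ∈-restrict⁻ Q? s x∈ ; y∈u , ry = ∈-restrict⁻ R? u y∈
    in no-edge x∈s y∈u (linked (s⊆t x∈s) (u⊆t y∈u) qx ry)

module Split {A : Set} {P : Pred A 0ℓ} (P? : Decidable P) where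

  part⁺ part⁻ : Term A → Maybe (Term A)
  part⁺ = restrict P?
  part⁻ = restrict (∁? P?)

  Splits : (Term A → Term A → Term A) → Term A → Set
  Splits h t = just t ⇝? join h (part⁺ t) (part⁻ t)

  private
    split-leaf : ∀ h a → Splits h (leaf a)
    split-leaf h a with does (P? a)
    ... | true  = ⇝?-refl
    ... | false = ⇝?-refl

    split-node : ∀ {g h s u} → (∀ {s s' u u'} → s ⇝* s' → u ⇝* u' → g s u ⇝* g s' u') →
      Splits h s → Splits h u →
      join g (join h (part⁺ s) (part⁻ s)) (join h (part⁺ u) (part⁻ u)) ⇝?
        join h (join g (part⁺ s) (part⁺ u)) (join g (part⁻ s) (part⁻ u)) →
      just (g s u) ⇝? join h (join g (part⁺ s) (part⁺ u)) (join g (part⁻ s) (part⁻ u))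
    split-node g* split-s split-u swap = ⇝?-trans (join-cong g* split-s split-u) swap

    ⊆-++ˡ : ∀ {xs ys : List A} → xs ⊆ xs ++ ys
    ⊆-++ˡ = ∈-++⁺ˡ

    ⊆-++ʳ : ∀ {xs ys : List A} → ys ⊆ xs ++ ys
    ⊆-++ʳ {xs} = ∈-++⁺ʳ xs

  module Node (s u : Term A) (disj : Disjoint (atoms s) (atoms u)) where

    private
      par-edge₁ : ∀ {x y} → x ∈ atoms s → y ∈ atoms s → ⟦ par s u ⟧ x y → ⟦ s ⟧ x y
      par-edge₁ _   _ (par₁ e) = e
      par-edge₁ x∈s _ (par₂ e) = ⊥-elim (disj (x∈s , proj₁ (edge-atoms u e)))

      par-edge₂ : ∀ {x y} → x ∈ atoms u → y ∈ atoms u → ⟦ par s u ⟧ x y → ⟦ u ⟧ x y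
      par-edge₂ x∈u _ (par₁ e) = ⊥-elim (disj (proj₁ (edge-atoms s e) , x∈u))
      par-edge₂ _   _ (par₂ e) = e

      tens-edge₁ : ∀ {x y} → x ∈ atoms s → y ∈ atoms s → ⟦ tens s u ⟧ x y → ⟦ s ⟧ x y
      tens-edge₁ _   _   (tens₁ e)      = e
      tens-edge₁ x∈s _   (tens₂ e)      = ⊥-elim (disj (x∈s , proj₁ (edge-atoms u e)))
      tens-edge₁ _   y∈s (tens₁₂ _ y∈u) = ⊥-elim (disj (y∈s , y∈u))
      tens-edge₁ x∈s _   (tens₂₁ x∈u _) = ⊥-elim (disj (x∈s , x∈u))

      tens-edge₂ : ∀ {x y} → x ∈ atoms u → y ∈ atoms u → ⟦ tens s u ⟧ x y → ⟦ u ⟧ x y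
      tens-edge₂ x∈u _   (tens₁ e)      = ⊥-elim (disj (proj₁ (edge-atoms s e) , x∈u))
      tens-edge₂ _   _   (tens₂ e)      = e
      tens-edge₂ x∈u _   (tens₁₂ x∈s _) = ⊥-elim (disj (x∈s , x∈u))
      tens-edge₂ _   y∈u (tens₂₁ _ y∈s) = ⊥-elim (disj (y∈s , y∈u))

      seq-edge₁ : ∀ {x y} → x ∈ atoms s → y ∈ atoms s → ⟦ seq s u ⟧ x y → ⟦ s ⟧ x y
      seq-edge₁ _   _   (seq₁ e)      = e
      seq-edge₁ x∈s _   (seq₂ e)      = ⊥-elim (disj (x∈s , proj₁ (edge-atoms u e)))
      seq-edge₁ _   y∈s (seq₁₂ _ y∈u) = ⊥-elim (disj (y∈s , y∈u))

      seq-edge₂ : ∀ {x y} → x ∈ atoms u → y ∈ atoms u → ⟦ seq s u ⟧ x y → ⟦ u ⟧ x y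
      seq-edge₂ x∈u _ (seq₁ e)      = ⊥-elim (disj (proj₁ (edge-atoms s e) , x∈u))
      seq-edge₂ _   _ (seq₂ e)      = e
      seq-edge₂ x∈u _ (seq₁₂ x∈s _) = ⊥-elim (disj (x∈s , x∈u))

      par-no-edge₁₂ : ∀ {x y} → x ∈ atoms s → y ∈ atoms u → ¬ ⟦ par s u ⟧ x y
      par-no-edge₁₂ _   y∈u (par₁ e) = disj (proj₂ (edge-atoms s e) , y∈u)
      par-no-edge₁₂ x∈s _   (par₂ e) = disj (x∈s , proj₁ (edge-atoms u e))

      par-no-edge₂₁ : ∀ {x y} → x ∈ atoms u → y ∈ atoms s → ¬ ⟦ par s u ⟧ x y
      par-no-edge₂₁ x∈u _   (par₁ e) = disj (proj₁ (edge-atoms s e) , x∈u)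
      par-no-edge₂₁ _   y∈s (par₂ e) = disj (y∈s , proj₂ (edge-atoms u e))

      seq-no-edge₂₁ : ∀ {x y} → x ∈ atoms u → y ∈ atoms s → ¬ ⟦ seq s u ⟧ x y
      seq-no-edge₂₁ x∈u _   (seq₁ e)      = disj (proj₁ (edge-atoms s e) , x∈u)
      seq-no-edge₂₁ _   y∈s (seq₂ e)      = disj (y∈s , proj₂ (edge-atoms u e))
      seq-no-edge₂₁ x∈u _   (seq₁₂ x∈s _) = disj (x∈s , x∈u)

    Linked-par₁ : ∀ {Q R} → Linked Q R (par s u) → Linked Q R s
    Linked-par₁ = Linked-sub {s = s} {t = par s u} ⊆-++ˡ par-edge₁

    Linked-par₂ : ∀ {Q R} → Linked Q R (par s u) → Linked Q R u
    Linked-par₂ = Linked-sub {s = u} {t = par s u} ⊆-++ʳ par-edge₂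

    Linked-tens₁ : ∀ {Q R} → Linked Q R (tens s u) → Linked Q R s
    Linked-tens₁ = Linked-sub {s = s} {t = tens s u} ⊆-++ˡ tens-edge₁

    Linked-tens₂ : ∀ {Q R} → Linked Q R (tens s u) → Linked Q R u
    Linked-tens₂ = Linked-sub {s = u} {t = tens s u} ⊆-++ʳ tens-edge₂

    Linked-seq₁ : ∀ {Q R} → Linked Q R (seq s u) → Linked Q R s
    Linked-seq₁ = Linked-sub {s = s} {t = seq s u} ⊆-++ˡ seq-edge₁

    Linked-seq₂ : ∀ {Q R} → Linked Q R (seq s u) → Linked Q R u
    Linked-seq₂ = Linked-sub {s = u} {t = seq s u} ⊆-++ʳ seq-edge₂

    par-exclusive₁₂ : Linked P (∁ P) (par s u) → Exclusive (part⁺ s) (part⁻ u)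
    par-exclusive₁₂ = Linked⇒Exclusive P? (∁? P?) {s} {u} {par s u} ⊆-++ˡ ⊆-++ʳ par-no-edge₁₂

    par-exclusive₂₁ : Linked P (∁ P) (par s u) → Exclusive (part⁺ u) (part⁻ s)
    par-exclusive₂₁ = Linked⇒Exclusive P? (∁? P?) {u} {s} {par s u} ⊆-++ʳ ⊆-++ˡ par-no-edge₂₁

    seq-exclusive₂₁ : Linked P (∁ P) (seq s u) → Exclusive (part⁺ u) (part⁻ s)
    seq-exclusive₂₁ = Linked⇒Exclusive P? (∁? P?) {u} {s} {seq s u} ⊆-++ʳ ⊆-++ˡ seq-no-edge₂₁

    seq-exclusive₂₁˘ : Linked (∁ P) P (seq s u) → Exclusive (part⁺ s) (part⁻ u)
    seq-exclusive₂₁˘ = Exclusive-sym {m = part⁻ u} {n = part⁺ s} ∘ Linked⇒Exclusive (∁? P?) P? {u} {s} {seq s u} ⊆-++ʳ ⊆-++ˡ seq-no-edge₂₁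

  split-par : ∀ t → Splits par t
  split-par (leaf a)   = split-leaf par a
  split-par (par s u)  = split-node par*  (split-par s) (split-par u) (interchange? par-par  (part⁺ s) (part⁻ s) (part⁺ u) (part⁻ u))
  split-par (tens s u) = split-node tens* (split-par s) (split-par u) (interchange? tens-par (part⁺ s) (part⁻ s) (part⁺ u) (part⁻ u))
  split-par (seq s u)  = split-node seq*  (split-par s) (split-par u) (interchange? seq-par  (part⁺ s) (part⁻ s) (part⁺ u) (part⁻ u))

  split-seq : ∀ t → Unique (atoms t) → Linked P (∁ P) t → Splits seq t
  split-seq (leaf a) _ _ = split-leaf seq a
  split-seq (par s u) uniq linked with Unique-++⁻ (atoms s) uniq
  ... | us , uu , disj =
    split-node par* (split-seq s us (Linked-par₁ linked)) (split-seq u uu (Linked-par₂ linked))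
      (≡⇒⇝? (interchange-exclusive (part⁺ s) (part⁻ s) (part⁺ u) (part⁻ u)
                (par-exclusive₁₂ linked) (par-exclusive₂₁ linked)))
    where open Node s u disj
  split-seq (tens s u) uniq linked with Unique-++⁻ (atoms s) uniq
  ... | us , uu , disj =
    split-node tens* (split-seq s us (Linked-tens₁ linked)) (split-seq u uu (Linked-tens₂ linked))
      (interchange? tens-seq (part⁺ s) (part⁻ s) (part⁺ u) (part⁻ u))
    where open Node s u disj
  split-seq (seq s u) uniq linked with Unique-++⁻ (atoms s) uniq
  ... | us , uu , disj =
    split-node seq* (split-seq s us (Linked-seq₁ linked)) (split-seq u uu (Linked-seq₂ linked))
      (interchange-seq (part⁺ s) (part⁻ s) (part⁺ u) (part⁻ u) (seq-exclusive₂₁ linked))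
    where open Node s u disj

  split-tens : ∀ t → Unique (atoms t) → Linked P (∁ P) t → Linked (∁ P) P t → Splits tens t
  split-tens (leaf a) _ _ _ = split-leaf tens a
  split-tens (par s u) uniq linked linked˘ with Unique-++⁻ (atoms s) uniq
  ... | us , uu , disj =
    split-node par* (split-tens s us (Linked-par₁ linked) (Linked-par₁ linked˘))
                    (split-tens u uu (Linked-par₂ linked) (Linked-par₂ linked˘))
      (≡⇒⇝? (interchange-exclusive (part⁺ s) (part⁻ s) (part⁺ u) (part⁻ u)
                (par-exclusive₁₂ linked) (par-exclusive₂₁ linked)))
    where open Node s u disj
  split-tens (tens s u) uniq linked linked˘ with Unique-++⁻ (atoms s) uniq
  ... | us , uu , disj =
    split-node tens* (split-tens s us (Linked-tens₁ linked) (Linked-tens₁ linked˘))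
                     (split-tens u uu (Linked-tens₂ linked) (Linked-tens₂ linked˘))
      (interchange? tens-tens (part⁺ s) (part⁻ s) (part⁺ u) (part⁻ u))
    where open Node s u disj
  split-tens (seq s u) uniq linked linked˘ with Unique-++⁻ (atoms s) uniq
  ... | us , uu , disj =
    split-node seq* (split-tens s us (Linked-seq₁ linked) (Linked-seq₁ linked˘))
                    (split-tens u uu (Linked-seq₂ linked) (Linked-seq₂ linked˘))
      (≡⇒⇝? (interchange-exclusive (part⁺ s) (part⁻ s) (part⁺ u) (part⁻ u)
                (seq-exclusive₂₁˘ linked˘) (seq-exclusive₂₁ linked)))
    where open Node s u disj

-- Completeness

module _ {A : Set} where

  Linked-across : ∀ {A' B' t : Term A} → (∀ {x y} → x ∈ atoms A' → y ∈ atoms B' → ⟦ t ⟧ x y) →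
    atoms t ⊆ atoms A' ++ atoms B' → Linked (_∈ atoms A') (∁ (_∈ atoms A')) t
  Linked-across edge t⊆ _ y∈t x∈A' y∉A' = edge x∈A' (∈-++-∉ˡ (t⊆ y∈t) y∉A')

  Linked-across˘ : ∀ {A' B' t : Term A} → (∀ {x y} → x ∈ atoms B' → y ∈ atoms A' → ⟦ t ⟧ x y) →
    atoms t ⊆ atoms A' ++ atoms B' → Linked (∁ (_∈ atoms A')) (_∈ atoms A') t
  Linked-across˘ edge t⊆ x∈t _ x∉A' y∈A' = edge (∈-++-∉ˡ (t⊆ x∈t) x∉A') y∈A'

  composite-not-singleton : ∀ s u {a : A} → Unique (atoms s ++ atoms u) → atoms s ++ atoms u ⊆ [ a ] → ⊥
  composite-not-singleton s u uniq sub with some-atom s | some-atom u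
  ... | x , x∈s | y , y∈u with sub (∈-++⁺ˡ x∈s) | sub (∈-++⁺ʳ (atoms s) y∈u)
  ... | here refl | here refl = proj₂ (proj₂ (Unique-++⁻ (atoms s) uniq)) (x∈s , y∈u)

  singleton⇒leaf : ∀ t {a : A} → Unique (atoms t) → atoms t ⊆ [ a ] → t ≡ leaf a
  singleton⇒leaf (leaf b)   _    sub with sub (here refl)
  ... | here refl = refl
  singleton⇒leaf (par s u)  uniq sub = ⊥-elim (composite-not-singleton s u uniq sub)
  singleton⇒leaf (tens s u) uniq sub = ⊥-elim (composite-not-singleton s u uniq sub)
  singleton⇒leaf (seq s u)  uniq sub = ⊥-elim (composite-not-singleton s u uniq sub)

module Completeness {A : Set} (_≟ᴬ_ : DecidableEquality A) where
  open import Data.List.Membership.DecPropositional _≟ᴬ_ using (_∈?_)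

  -- The source may be empty so that the restrictions of a term can be fed back directly.
  Completes : Term A → Set
  Completes t' = ∀ {m} → Unique (atoms? m) → atoms t' ⊆ atoms? m → atoms? m ⊆ atoms t' →
                 ⟦ t' ⟧ ⇒ ⟦ m ⟧? → m ⇝? just t'

  complete-composite : ∀ {g : Term A → Term A → Term A} {A' B' t} →
    (∀ {s s' u u'} → s ⇝* s' → u ⇝* u' → g s u ⇝* g s' u') → Disjoint (atoms A') (atoms B') →
    Unique (atoms t) → atoms A' ++ atoms B' ⊆ atoms t → atoms t ⊆ atoms A' ++ atoms B' →
    ⟦ A' ⟧ ⇒ ⟦ t ⟧ → ⟦ B' ⟧ ⇒ ⟦ t ⟧ → Completes A' → Completes B' →
    Split.Splits (_∈? atoms A') g t → just t ⇝? just (g A' B')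
  complete-composite {A' = A'} {B'} {t} g* disj uniq A'B'⊆t t⊆A'B' A'-edges B'-edges complete-A' complete-B' split =
    ⇝?-trans split (join-cong g*
      (complete-A' {restrict P? t} (Unique-restrict P? t uniq)
        (λ x∈A' → ∈-restrict⁺ P? t (A'B'⊆t (∈-++⁺ˡ x∈A')) x∈A')
        (proj₂ ∘ ∈-restrict⁻ P? t)
        (λ e → let x∈ , y∈ = edge-atoms A' e in restrict-edges P? t (A'-edges e) x∈ y∈))
      (complete-B' {restrict (∁? P?) t} (Unique-restrict (∁? P?) t uniq)
        (λ x∈B' → ∈-restrict⁺ (∁? P?) t (A'B'⊆t (∈-++⁺ʳ (atoms A') x∈B')) (∉A' x∈B'))
        (λ x∈ → let x∈t , x∉A' = ∈-restrict⁻ (∁? P?) t x∈ in ∈-++-∉ˡ (t⊆A'B' x∈t) x∉A')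
        (λ e → let x∈ , y∈ = edge-atoms B' e in restrict-edges (∁? P?) t (B'-edges e) (∉A' x∈) (∉A' y∈))))
    where
      P? = _∈? atoms A'
      ∉A' : ∀ {x} → x ∈ atoms B' → x ∉ atoms A'
      ∉A' x∈B' x∈A' = disj (x∈A' , x∈B')

  complete : ∀ t' → Unique (atoms t') → Completes t'
  complete t' _ {nothing} _ t'⊆ _ _ with t'⊆ (proj₂ (some-atom t'))
  ... | ()
  complete (leaf a) _ {just t} uniq _ t⊆a _ with singleton⇒leaf t uniq t⊆a
  ... | refl = just ε
  complete (par A' B') uniq' {just t} uniq t'⊆t t⊆t' edges with Unique-++⁻ (atoms A') uniq'
  ... | uA' , uB' , disj =
    complete-composite par* disj uniq t'⊆t t⊆t' (edges ∘ par₁) (edges ∘ par₂) (complete A' uA') (complete B' uB')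
      (Split.split-par (_∈? atoms A') t)
  complete (seq A' B') uniq' {just t} uniq t'⊆t t⊆t' edges with Unique-++⁻ (atoms A') uniq'
  ... | uA' , uB' , disj =
    complete-composite seq* disj uniq t'⊆t t⊆t' (edges ∘ seq₁) (edges ∘ seq₂) (complete A' uA') (complete B' uB')
      (Split.split-seq (_∈? atoms A') t uniq (Linked-across {A' = A'} {B'} (λ x∈ y∈ → edges (seq₁₂ x∈ y∈)) t⊆t'))
  complete (tens A' B') uniq' {just t} uniq t'⊆t t⊆t' edges with Unique-++⁻ (atoms A') uniq'
  ... | uA' , uB' , disj =
    complete-composite tens* disj uniq t'⊆t t⊆t' (edges ∘ tens₁) (edges ∘ tens₂) (complete A' uA') (complete B' uB')
      (Split.split-tens (_∈? atoms A') t uniq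
        (Linked-across {A' = A'} {B'} (λ x∈ y∈ → edges (tens₁₂ x∈ y∈)) t⊆t')
        (Linked-across˘ {A' = A'} {B'} (λ x∈ y∈ → edges (tens₂₁ x∈ y∈)) t⊆t'))

module _ {n : ℕ} where

  Linear⇒Unique : {t : Term (Fin n)} → Linear t → Unique (atoms t)
  Linear⇒Unique lin = ↭ₛ.Unique-resp-↭ (setoid _) (↭⇒↭ₛ (↭-sym lin)) (allFin⁺ n)

  ∈-Linear : {t : Term (Fin n)} → Linear t → ∀ x → x ∈ atoms t
  ∈-Linear lin x = ↭.∈-resp-↭ (↭-sym lin) (∈-allFin x)

  Linear-complete : {t t' : Term (Fin n)} → Linear t → Linear t' → ⟦ t' ⟧ ⇒ ⟦ t ⟧ → t ⇝* t'
  Linear-complete {t} {t'} lin lin' edges =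
    drop-just (complete t' (Linear⇒Unique {t'} lin') (Linear⇒Unique {t} lin)
                 (λ {x} _ → ∈-Linear {t} lin x) (λ {x} _ → ∈-Linear {t'} lin' x) edges)
    where open Completeness _≟_

mainTheorem2 : (n : ℕ) (R R' : Rel (Fin n) 0ℓ) → Dicograph n R → Dicograph n R' →
    (R' ⊆ᴿ R) ⇔ (Σ[ t ∈ Term (Fin n) ] Σ[ t' ∈ Term (Fin n) ]
                   (Linear t × Denotes t R × Linear t' × Denotes t' R' × t ⇝* t'))
mainTheorem2 n R R' (t , lin , den) (t' , lin' , den') = mk⇔ rewrites included
  where
    rewrites : R' ⊆ᴿ R → Σ[ t ∈ Term (Fin n) ] Σ[ t' ∈ Term (Fin n) ]
                 (Linear t × Denotes t R × Linear t' × Denotes t' R' × t ⇝* t')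
    rewrites R'⊆R = t , t' , lin , den , lin' , den' ,
      Linear-complete lin lin' (λ {x} {y} e → proj₂ (den x y) (R'⊆R x y (proj₁ (den' x y) e)))

    included : Σ[ t ∈ Term (Fin n) ] Σ[ t' ∈ Term (Fin n) ]
                 (Linear t × Denotes t R × Linear t' × Denotes t' R' × t ⇝* t') → R' ⊆ᴿ R
    included (s , s' , _ , den-s , _ , den-s' , s⇝s') x y r =
      proj₁ (den-s x y) (proj₂ (⇝*⇒⊒ s⇝s') (proj₂ (den-s' x y) r))
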